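{- Let $\mathcal V$ be a subspace of $\mathbb F_2^n$ of co-dimension $C$ and let $\mathcal W$ be a subspace with $\mathcal W\oplus\mathcal V^\perp=\mathbb F_2^n$. For each positive integer $\ell\le C+1$, there exists $S_\ell\subseteq\mathcal W$ with $|S_\ell|\ge n-C(\ell+1)$ such that every $\gamma\in S_\ell$ satisfies: (1) $|(\gamma+\mathcal V^\perp)^{=1}|=1$, and (2) $|(\gamma+\mathcal V^\perp)^{=t}|\le2\binom{2C+1}{t-1}$ for each positive integer $t\le\ell$.
   Context: $\mathcal V^\perp=\{\gamma:\langle\gamma,v\rangle=0\ \forall v\in\mathcal V\}$; $\mathcal W\oplus\mathcal V^\perp=\mathbb F_2^n$ means $\mathcal W\cap\mathcal V^\perp=\{0\}$ and $\mathcal W+\mathcal V^\perp=\mathbb F_2^n$. For $A\subseteq\mathbb F_2^n$, $A^{=t}=\{u\in A:\|u\|_1=t\}$, $\|u\|_1$ the Hamming weight. -}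

module Defs where

open import Data.Bool using (Bool; true; false; _xor_; _∧_; _∨_; not; T; T?)
open import Data.Nat using (ℕ; zero; suc; _+_)
open import Data.List using (List; []; _∷_; length; filterᵇ; map)
open import Data.Bool.ListAction using (and)
open import Data.Vec using (Vec; []; _∷_; replicate; zipWith; foldr; count)
open import Data.Product using (Σ; ∃; ∃-syntax; _×_; _,_)
open import Data.Nat using (_≡ᵇ_)
open import Relation.Binary.PropositionalEquality using (_≡_)
open import Relation.Nullary using (¬_)

-- Vectors of 𝔽₂ⁿ : entries true = 1, false = 0
𝔽₂^ : ℕ → Set
𝔽₂^ n = Vec Bool n

_⊕_ : ∀ {n} → 𝔽₂^ n → 𝔽₂^ n → 𝔽₂^ n
_⊕_ = zipWith _xor_

𝟎 : ∀ {n} → 𝔽₂^ n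
𝟎 = replicate _ false

_·_ : ∀ {n} → Bool → 𝔽₂^ n → 𝔽₂^ n
c · v = Data.Vec.map (c ∧_) v

⟨_,_⟩ : ∀ {n} → 𝔽₂^ n → 𝔽₂^ n → Bool
⟨ x , y ⟩ = foldr _ _xor_ false (zipWith _∧_ x y)

weight : ∀ {n} → 𝔽₂^ n → ℕ
weight u = count T? u

allVecs : (n : ℕ) → List (𝔽₂^ n)
allVecs zero = [] ∷ []
allVecs (suc n) = map (false ∷_) (allVecs n) Data.List.++ map (true ∷_) (allVecs n)

Subset : ℕ → Set
Subset n = 𝔽₂^ n → Bool

_∈_ : ∀ {n} → 𝔽₂^ n → Subset n → Set
x ∈ A = T (A x)

record IsSubspace {n : ℕ} (V : Subset n) : Set where
  field
    zero-mem : 𝟎 ∈ V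
    add-mem  : ∀ u v → u ∈ V → v ∈ V → (u ⊕ v) ∈ V

lincomb : ∀ {n d} → Vec (𝔽₂^ n) d → Vec Bool d → 𝔽₂^ n
lincomb [] [] = 𝟎
lincomb (b ∷ bs) (c ∷ cs) = (c · b) ⊕ lincomb bs cs

record IsBasis {n d : ℕ} (V : Subset n) (bs : Vec (𝔽₂^ n) d) : Set where
  field
    members     : ∀ cs → lincomb bs cs ∈ V
    independent : ∀ cs → lincomb bs cs ≡ 𝟎 → cs ≡ replicate d false
    spanning    : ∀ v → v ∈ V → ∃[ cs ] lincomb bs cs ≡ v

HasDim : ∀ {n} → Subset n → ℕ → Set
HasDim {n} V d = Σ (Vec (𝔽₂^ n) d) (IsBasis V)

HasCodim : ∀ {n} → Subset n → ℕ → Set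
HasCodim {n} V C = ∃[ d ] (d + C ≡ n × HasDim V d)

_⊥ : ∀ {n} → Subset n → Subset n
_⊥ {n} V γ = and (map (λ v → not (V v) ∨ not ⟨ γ , v ⟩) (allVecs n))

DirectSumWhole : ∀ {n} → Subset n → Subset n → Set
DirectSumWhole W U =
  (∀ x → x ∈ W → x ∈ U → x ≡ 𝟎) ×
  (∀ x → ∃[ w ] ∃[ u ] (w ∈ W × u ∈ U × x ≡ w ⊕ u))

-- |(γ + U)^{=t}| : number of u ∈ γ + U with ‖u‖₁ = t
-- (u ∈ γ + U  iff  u ⊕ γ ∈ U)
cosetWeightCount : ∀ {n} → 𝔽₂^ n → Subset n → ℕ → ℕ
cosetWeightCount {n} γ U t =
  length (filterᵇ (λ u → U (u ⊕ γ) ∧ (weight u ≡ᵇ t)) (allVecs n))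

-- Write U = V ⊥, a space of dimension c. Call a set R of coordinates a pivot set if no nonzero
-- vector of V is supported in R: pivot sets have at most c elements, and Gaussian elimination on
-- U enlarges them one coordinate at a time. Run greedily, it yields an information set Q of U
-- (∣ Q ∣ ≤ c, and a vector of U is determined by its restriction to Q) and a set K of at most
-- c (ℓ + 1) coordinates containing the support of every vector of U of weight at most ℓ + 1.
-- For a coordinate i ∉ K and a vector u of weight t ≤ ℓ in the coset eᵢ + U, the vector u + eᵢ
-- lies in U and has weight at most ℓ + 1, so its support misses i: hence uᵢ = 1 and u + eᵢ has
-- weight t - 1. So eᵢ is the only vector of weight one in its coset, and restriction to Q maps
-- the vectors of weight t of the coset injectively into words of length ∣ Q ∣ and weight below t,
-- of which there are at most C(∣ Q ∣ + t - 1, t - 1). Distinct coordinates outside K lie in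
-- distinct cosets, so their representatives in W form the required S, of size n - ∣ K ∣.

module Submission where

open import Defs
open import Algebra.Bundles using (CommutativeRing)
open import Data.Bool using (Bool; true; false; not; _xor_; _∧_; _∨_; T)
open import Data.Bool.Properties
  using (xor-assoc; xor-comm; xor-identityˡ; xor-identityʳ; xor-same; ∧-distribʳ-xor;
         xor-∧-commutativeRing; T?; T-∧; T-not-≡)
open import Data.Fin using (Fin; zero; suc)
open import Data.Fin.Subset using (_∪_; _∩_; ∁; ⁅_⁆; ∣_∣; Nonempty; _⊂_; _⊃_)
  renaming (_∈_ to _∈ᶜ_; _∉_ to _∉ᶜ_; _⊆_ to _⊆ᶜ_)
open import Data.Fin.Subset.Induction using (⊃-wellFounded; Acc; acc)
open import Data.Fin.Subset.Properties
open import Data.List using (List; []; _∷_; _++_; length; map; filter; filterᵇ; allFin; tabulate)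
open import Data.List.Membership.Propositional using (lose) renaming (_∈_ to _∈ₗ_)
open import Data.List.Membership.Propositional.Properties
  using (∈-++⁺ˡ; ∈-++⁺ʳ; ∈-++⁻; ∈-map⁺; ∈-map⁻; ∈-∃++; ∈-filter⁺; ∈-filter⁻)
open import Data.List.Properties
  using (length-++; length-map; length-++-sucʳ; filter-++; filter-≐; filter-none; filter-some;
         map-tabulate)
open import Data.List.Relation.Binary.Disjoint.Propositional using (Disjoint)
open import Data.List.Relation.Unary.All as All using (All; []; _∷_)
import Data.List.Relation.Unary.All.Properties as All
open import Data.List.Relation.Unary.AllPairs using ([]; _∷_)
open import Data.List.Relation.Unary.Any using (here; there; any?; satisfied)
open import Data.List.Relation.Unary.Unique.Propositional using (Unique)
import Data.List.Relation.Unary.Unique.Propositional.Properties as UP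
open import Data.Nat
  using (ℕ; zero; suc; _+_; _*_; _∸_; _^_; _≤_; _≥_; z≤n; s≤s; s≤s⁻¹; _≤?_; _≤′_; ≤′-refl; ≤′-step;
         _≡ᵇ_)
open import Data.Nat.Combinatorics using (_C_; nCn≡1; nCk+nC[k+1]≡[n+1]C[k+1])
open import Data.Nat.Properties
open import Data.Product using (_,_; ∃; ∃-syntax; _×_; proj₁; proj₂)
import Data.Product as Product
open import Data.Sum using (_⊎_; inj₁; inj₂)
import Data.Sum as Sum
open import Data.Unit using (⊤; tt)
open import Data.Vec using (Vec; []; _∷_; here; there; foldr)
import Data.Vec as Vec
open import Data.Vec.Properties
  using (zipWith-assoc; zipWith-comm; zipWith-identityˡ; zipWith-identityʳ; ∷-injectiveʳ)
open import Function using (_∘_; id)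
open import Function.Bundles using (Equivalence)
open import Function.Definitions using (Injective)
open import Relation.Binary.PropositionalEquality
open import Relation.Nullary using (Dec; yes; no; does)
open import Relation.Nullary.Decidable using (map′; _×-dec_)
open import Relation.Nullary.Negation using (contradiction)
open import Relation.Unary using (Decidable)

open import Algebra.Properties.CommutativeSemigroup
  (CommutativeRing.+-commutativeSemigroup xor-∧-commutativeRing)
  using () renaming (interchange to xor-interchange)

⊕-assoc : ∀ {n} (x y z : 𝔽₂^ n) → (x ⊕ y) ⊕ z ≡ x ⊕ (y ⊕ z)
⊕-assoc = zipWith-assoc xor-assoc

⊕-comm : ∀ {n} (x y : 𝔽₂^ n) → x ⊕ y ≡ y ⊕ x
⊕-comm = zipWith-comm xor-comm

⊕-identityˡ : ∀ {n} (x : 𝔽₂^ n) → 𝟎 ⊕ x ≡ x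
⊕-identityˡ = zipWith-identityˡ xor-identityˡ

⊕-identityʳ : ∀ {n} (x : 𝔽₂^ n) → x ⊕ 𝟎 ≡ x
⊕-identityʳ = zipWith-identityʳ xor-identityʳ

⊕-self : ∀ {n} (x : 𝔽₂^ n) → x ⊕ x ≡ 𝟎
⊕-self []      = refl
⊕-self (a ∷ x) = cong₂ _∷_ (xor-same a) (⊕-self x)

x⊕y⊕y≡x : ∀ {n} (x y : 𝔽₂^ n) → (x ⊕ y) ⊕ y ≡ x
x⊕y⊕y≡x x y = begin
  (x ⊕ y) ⊕ y ≡⟨ ⊕-assoc x y y ⟩
  x ⊕ (y ⊕ y) ≡⟨ cong (x ⊕_) (⊕-self y) ⟩
  x ⊕ 𝟎       ≡⟨ ⊕-identityʳ x ⟩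
  x           ∎
  where open ≡-Reasoning

⊕-cancelʳ-≡ : ∀ {n} {x y z : 𝔽₂^ n} → x ⊕ z ≡ y ⊕ z → x ≡ y
⊕-cancelʳ-≡ {x = x} {y} {z} eq = begin
  x           ≡⟨ x⊕y⊕y≡x x z ⟨
  (x ⊕ z) ⊕ z ≡⟨ cong (_⊕ z) eq ⟩
  (y ⊕ z) ⊕ z ≡⟨ x⊕y⊕y≡x y z ⟩
  y           ∎
  where open ≡-Reasoning

⊕≡𝟎⇒≡ : ∀ {n} {x y : 𝔽₂^ n} → x ⊕ y ≡ 𝟎 → x ≡ y
⊕≡𝟎⇒≡ {x = x} {y} eq = begin
  x           ≡⟨ sym (x⊕y⊕y≡x x y) ⟩
  (x ⊕ y) ⊕ y ≡⟨ cong (_⊕ y) eq ⟩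
  𝟎 ⊕ y       ≡⟨ ⊕-identityˡ y ⟩
  y           ∎
  where open ≡-Reasoning

⊕-telescope : ∀ {n} (x y z : 𝔽₂^ n) → (x ⊕ y) ⊕ (y ⊕ z) ≡ x ⊕ z
⊕-telescope x y z = begin
  (x ⊕ y) ⊕ (y ⊕ z) ≡⟨ sym (⊕-assoc (x ⊕ y) y z) ⟩
  ((x ⊕ y) ⊕ y) ⊕ z ≡⟨ cong (_⊕ z) (x⊕y⊕y≡x x y) ⟩
  x ⊕ z             ∎
  where open ≡-Reasoning

⊕-interchange : ∀ {n} (w x y z : 𝔽₂^ n) → (w ⊕ x) ⊕ (y ⊕ z) ≡ (w ⊕ y) ⊕ (x ⊕ z)
⊕-interchange w x y z = begin
  (w ⊕ x) ⊕ (y ⊕ z) ≡⟨ ⊕-assoc w x (y ⊕ z) ⟩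
  w ⊕ (x ⊕ (y ⊕ z)) ≡⟨ cong (w ⊕_) (sym (⊕-assoc x y z)) ⟩
  w ⊕ ((x ⊕ y) ⊕ z) ≡⟨ cong (λ v → w ⊕ (v ⊕ z)) (⊕-comm x y) ⟩
  w ⊕ ((y ⊕ x) ⊕ z) ≡⟨ cong (w ⊕_) (⊕-assoc y x z) ⟩
  w ⊕ (y ⊕ (x ⊕ z)) ≡⟨ sym (⊕-assoc w y (x ⊕ z)) ⟩
  (w ⊕ y) ⊕ (x ⊕ z) ∎
  where open ≡-Reasoning

·-distribʳ-xor : ∀ {n} (x : 𝔽₂^ n) a b → (a xor b) · x ≡ (a · x) ⊕ (b · x)
·-distribʳ-xor []      a b = refl
·-distribʳ-xor (u ∷ x) a b = cong₂ _∷_ (∧-distribʳ-xor u a b) (·-distribʳ-xor x a b)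

lincomb-⊕ : ∀ {n d} (bs : Vec (𝔽₂^ n) d) (cs cs′ : 𝔽₂^ d) →
            lincomb bs (cs ⊕ cs′) ≡ lincomb bs cs ⊕ lincomb bs cs′
lincomb-⊕ []       []       []         = sym (⊕-self 𝟎)
lincomb-⊕ (b ∷ bs) (c ∷ cs) (c′ ∷ cs′) = begin
  ((c xor c′) · b) ⊕ lincomb bs (cs ⊕ cs′)
    ≡⟨ cong₂ _⊕_ (·-distribʳ-xor b c c′) (lincomb-⊕ bs cs cs′) ⟩
  ((c · b) ⊕ (c′ · b)) ⊕ (lincomb bs cs ⊕ lincomb bs cs′)
    ≡⟨ ⊕-interchange (c · b) (c′ · b) (lincomb bs cs) (lincomb bs cs′) ⟩
  ((c · b) ⊕ lincomb bs cs) ⊕ ((c′ · b) ⊕ lincomb bs cs′)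
    ∎
  where open ≡-Reasoning

-- A vector of 𝔽₂ⁿ doubles as the set of its nonzero coordinates (a Data.Fin.Subset), so that
-- ∣ u ∣ is its Hamming weight, ⊕ is symmetric difference and ⁅ i ⁆ is the i-th unit vector.

∈-⊕⁻ : ∀ {n} (x y : 𝔽₂^ n) {i} → i ∈ᶜ x ⊕ y → i ∈ᶜ x ⊎ i ∈ᶜ y
∈-⊕⁻ (true  ∷ x) (b     ∷ y) {zero}  _         = inj₁ here
∈-⊕⁻ (false ∷ x) (true  ∷ y) {zero}  _         = inj₂ here
∈-⊕⁻ (false ∷ x) (false ∷ y) {zero}  ()
∈-⊕⁻ (a     ∷ x) (b     ∷ y) {suc i} (there p) = Sum.map there there (∈-⊕⁻ x y p)

∈-⊕⁺ˡ : ∀ {n} (x y : 𝔽₂^ n) {i} → i ∈ᶜ x → i ∉ᶜ y → i ∈ᶜ x ⊕ y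
∈-⊕⁺ˡ (true ∷ x) (true  ∷ y) here      i∉y = contradiction here i∉y
∈-⊕⁺ˡ (true ∷ x) (false ∷ y) here      i∉y = here
∈-⊕⁺ˡ (a    ∷ x) (b     ∷ y) (there p) i∉y = there (∈-⊕⁺ˡ x y p (i∉y ∘ there))

∈-⊕⁺ʳ : ∀ {n} (x y : 𝔽₂^ n) {i} → i ∉ᶜ x → i ∈ᶜ y → i ∈ᶜ x ⊕ y
∈-⊕⁺ʳ x y i∉x i∈y = subst (_ ∈ᶜ_) (⊕-comm y x) (∈-⊕⁺ˡ y x i∈y i∉x)

∉-⊕ : ∀ {n} (x y : 𝔽₂^ n) {i} → i ∈ᶜ x → i ∈ᶜ y → i ∉ᶜ x ⊕ y
∉-⊕ (true ∷ x) (true ∷ y) here      here      = λ ()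
∉-⊕ (a    ∷ x) (b    ∷ y) (there p) (there q) = ∉-⊕ x y p q ∘ drop-there

⊕⊆∪ : ∀ {n} (x y : 𝔽₂^ n) → x ⊕ y ⊆ᶜ x ∪ y
⊕⊆∪ x y = x∈p∪q⁺ ∘ ∈-⊕⁻ x y

⊕-⊆ : ∀ {n} {x y p : 𝔽₂^ n} → x ⊆ᶜ p → y ⊆ᶜ p → x ⊕ y ⊆ᶜ p
⊕-⊆ {x = x} {y} x⊆p y⊆p = Sum.[ x⊆p , y⊆p ] ∘ ∈-⊕⁻ x y

⊂∪⁅⁆ : ∀ {n} {R : 𝔽₂^ n} {i} → i ∉ᶜ R → R ⊂ R ∪ ⁅ i ⁆
⊂∪⁅⁆ {i = i} i∉R = p⊆p∪q _ , i , x∈p∪q⁺ (inj₂ (x∈⁅x⁆ i)) , i∉R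

⊆∁∪⁅⁆ : ∀ {n} {y R : 𝔽₂^ n} {i} → y ⊆ᶜ ∁ R → i ∉ᶜ y → y ⊆ᶜ ∁ (R ∪ ⁅ i ⁆)
⊆∁∪⁅⁆ {y = y} {R} {i} y⊆∁R i∉y {j} j∈y = x∉p⇒x∈∁p λ j∈R∪⁅i⁆ →
  Sum.[ x∈∁p⇒x∉p (y⊆∁R j∈y) , (λ j∈⁅i⁆ → i∉y (subst (_∈ᶜ y) (x∈⁅y⁆⇒x≡y i j∈⁅i⁆) j∈y)) ]
    (x∈p∪q⁻ R ⁅ i ⁆ j∈R∪⁅i⁆)

weight≡∣∣ : ∀ {n} (u : 𝔽₂^ n) → weight u ≡ ∣ u ∣
weight≡∣∣ []          = refl
weight≡∣∣ (true  ∷ u) = cong suc (weight≡∣∣ u)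
weight≡∣∣ (false ∷ u) = weight≡∣∣ u

∣∪∣≤ : ∀ {n} (p q : 𝔽₂^ n) → ∣ p ∪ q ∣ ≤ ∣ p ∣ + ∣ q ∣
∣∪∣≤ []          []          = z≤n
∣∪∣≤ (true  ∷ p) (true  ∷ q) = s≤s (≤-trans (∣∪∣≤ p q) (+-monoʳ-≤ ∣ p ∣ (n≤1+n ∣ q ∣)))
∣∪∣≤ (true  ∷ p) (false ∷ q) = s≤s (∣∪∣≤ p q)
∣∪∣≤ (false ∷ p) (true  ∷ q) = ≤-trans (s≤s (∣∪∣≤ p q)) (≤-reflexive (sym (+-suc ∣ p ∣ ∣ q ∣)))
∣∪∣≤ (false ∷ p) (false ∷ q) = ∣∪∣≤ p q

∣⊕∣≤ : ∀ {n} (x y : 𝔽₂^ n) → ∣ x ⊕ y ∣ ≤ ∣ x ∣ + ∣ y ∣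
∣⊕∣≤ x y = ≤-trans (p⊆q⇒∣p∣≤∣q∣ (⊕⊆∪ x y)) (∣∪∣≤ x y)

∣⊕⁅⁆∣ : ∀ {n} (u : 𝔽₂^ n) {i} → i ∈ᶜ u → suc ∣ u ⊕ ⁅ i ⁆ ∣ ≡ ∣ u ∣
∣⊕⁅⁆∣ (true ∷ u)  here      = cong (suc ∘ ∣_∣) (⊕-identityʳ u)
∣⊕⁅⁆∣ (true ∷ u)  (there p) = cong suc (∣⊕⁅⁆∣ u p)
∣⊕⁅⁆∣ (false ∷ u) (there p) = ∣⊕⁅⁆∣ u p

∣∣≡0⇒≡𝟎 : ∀ {n} (u : 𝔽₂^ n) → ∣ u ∣ ≡ 0 → u ≡ 𝟎
∣∣≡0⇒≡𝟎 []          _  = refl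
∣∣≡0⇒≡𝟎 (false ∷ u) eq = cong (false ∷_) (∣∣≡0⇒≡𝟎 u eq)

-- ⟨ x , y ⟩ is definitionally parity (x ∩ y).
parity : ∀ {n} → 𝔽₂^ n → Bool
parity = foldr _ _xor_ false

parity-𝟎 : ∀ {n} → parity (𝟎 {n}) ≡ false
parity-𝟎 {zero}  = refl
parity-𝟎 {suc n} = parity-𝟎 {n}

parity-⁅⁆ : ∀ {n} (i : Fin n) → parity ⁅ i ⁆ ≡ true
parity-⁅⁆ {suc n} zero = cong (true xor_) (parity-𝟎 {n})
parity-⁅⁆ (suc i)      = parity-⁅⁆ i

parity-⊆⁅⁆ : ∀ {n} {p : 𝔽₂^ n} {i} → p ⊆ᶜ ⁅ i ⁆ → i ∈ᶜ p → parity p ≡ true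
parity-⊆⁅⁆ {p = p} {i} p⊆⁅i⁆ i∈p = trans (cong parity (⊆-antisym p⊆⁅i⁆ ⁅i⁆⊆p)) (parity-⁅⁆ i)
  where
  ⁅i⁆⊆p : ⁅ i ⁆ ⊆ᶜ p
  ⁅i⁆⊆p j∈⁅i⁆ = subst (_∈ᶜ p) (sym (x∈⁅y⁆⇒x≡y i j∈⁅i⁆)) i∈p

⟨⊕,⟩ : ∀ {n} (x y z : 𝔽₂^ n) → ⟨ x ⊕ y , z ⟩ ≡ ⟨ x , z ⟩ xor ⟨ y , z ⟩
⟨⊕,⟩ []      []      []      = refl
⟨⊕,⟩ (a ∷ x) (b ∷ y) (c ∷ z) = begin
  ((a xor b) ∧ c) xor ⟨ x ⊕ y , z ⟩
    ≡⟨ cong₂ _xor_ (∧-distribʳ-xor c a b) (⟨⊕,⟩ x y z) ⟩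
  ((a ∧ c) xor (b ∧ c)) xor (⟨ x , z ⟩ xor ⟨ y , z ⟩)
    ≡⟨ xor-interchange (a ∧ c) (b ∧ c) ⟨ x , z ⟩ ⟨ y , z ⟩ ⟩
  ((a ∧ c) xor ⟨ x , z ⟩) xor ((b ∧ c) xor ⟨ y , z ⟩)
    ∎
  where open ≡-Reasoning

⟨𝟎,⟩ : ∀ {n} (y : 𝔽₂^ n) → ⟨ 𝟎 , y ⟩ ≡ false
⟨𝟎,⟩ []      = refl
⟨𝟎,⟩ (b ∷ y) = ⟨𝟎,⟩ y

allVecs-complete : ∀ {n} (x : 𝔽₂^ n) → x ∈ₗ allVecs n
allVecs-complete []                  = here refl
allVecs-complete {suc n} (false ∷ x) = ∈-++⁺ˡ (∈-map⁺ (false ∷_) (allVecs-complete x))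
allVecs-complete {suc n} (true  ∷ x) =
  ∈-++⁺ʳ (map (false ∷_) (allVecs n)) (∈-map⁺ (true ∷_) (allVecs-complete x))

allVecs-unique : ∀ n → Unique (allVecs n)
allVecs-unique zero    = [] ∷ []
allVecs-unique (suc n) = UP.++⁺ (UP.map⁺ ∷-injectiveʳ (allVecs-unique n))
                                (UP.map⁺ ∷-injectiveʳ (allVecs-unique n)) disjoint
  where
  disjoint : Disjoint (map (false ∷_) (allVecs n)) (map (true ∷_) (allVecs n))
  disjoint (p , q) with ∈-map⁻ (false ∷_) p | ∈-map⁻ (true ∷_) q
  ... | _ , _ , refl | _ , _ , ()

length-allVecs : ∀ n → length (allVecs n) ≡ 2 ^ n
length-allVecs zero    = refl
length-allVecs (suc n) = begin
  length (map (false ∷_) (allVecs n) ++ map (true ∷_) (allVecs n))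
    ≡⟨ length-++ (map (false ∷_) (allVecs n)) ⟩
  length (map (false ∷_) (allVecs n)) + length (map (true ∷_) (allVecs n))
    ≡⟨ cong₂ _+_ (length-map (false ∷_) (allVecs n)) (length-map (true ∷_) (allVecs n)) ⟩
  length (allVecs n) + length (allVecs n)
    ≡⟨ cong (λ m → m + m) (length-allVecs n) ⟩
  2 ^ n + 2 ^ n
    ≡⟨ cong (2 ^ n +_) (sym (+-identityʳ (2 ^ n))) ⟩
  2 ^ n + (2 ^ n + 0)
    ∎
  where open ≡-Reasoning

anyVec? : ∀ {n} {P : 𝔽₂^ n → Set} → Decidable P → Dec (∃ P)
anyVec? P? = map′ satisfied (λ (x , px) → lose (allVecs-complete x) px) (any? P? (allVecs _))

module _ {n} (V : Subset n) where

  ⊥-orthogonal : ∀ γ v → γ ∈ (V ⊥) → v ∈ V → ⟨ γ , v ⟩ ≡ false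
  ⊥-orthogonal γ v γ∈V⊥ v∈V
    with V v | All.lookup (All.all⁺ _ (allVecs n) γ∈V⊥) (allVecs-complete v)
  ... | true | ⟨γ,v⟩≢true = Equivalence.to T-not-≡ ⟨γ,v⟩≢true

  ⊥-intro : ∀ γ → (∀ v → v ∈ V → ⟨ γ , v ⟩ ≡ false) → γ ∈ (V ⊥)
  ⊥-intro γ orth = All.all⁻ _ {allVecs n} (All.tabulate λ {v} _ → entry v (orth v))
    where
    entry : ∀ v → (v ∈ V → ⟨ γ , v ⟩ ≡ false) → T (not (V v) ∨ not ⟨ γ , v ⟩)
    entry v orth-v with V v
    ... | false = _
    ... | true  rewrite orth-v _ = _

  ⊥-isSubspace : IsSubspace (V ⊥)
  ⊥-isSubspace = record
    { zero-mem = ⊥-intro 𝟎 (λ v _ → ⟨𝟎,⟩ v)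
    ; add-mem  = λ x y x⊥ y⊥ → ⊥-intro (x ⊕ y) λ v v∈V → begin
        ⟨ x ⊕ y , v ⟩             ≡⟨ ⟨⊕,⟩ x y v ⟩
        ⟨ x , v ⟩ xor ⟨ y , v ⟩
          ≡⟨ cong₂ _xor_ (⊥-orthogonal x v x⊥ v∈V) (⊥-orthogonal y v y⊥ v∈V) ⟩
        false                     ∎
    }
    where open ≡-Reasoning

injectiveOn⇒length≤ : ∀ {A B : Set} {f : A → B} {xs : List A} {ys : List B} → Unique xs →
                       (∀ {x y} → x ∈ₗ xs → y ∈ₗ xs → f x ≡ f y → x ≡ y) →
                       (∀ {x} → x ∈ₗ xs → f x ∈ₗ ys) → length xs ≤ length ys
injectiveOn⇒length≤ {xs = []} _ _ _ = z≤n
injectiveOn⇒length≤ {f = f} {xs = x ∷ xs} (x∉xs ∷ xs!) inj into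
  with ys₁ , ys₂ , refl ← ∈-∃++ (into (here refl)) = begin
    suc (length xs)           ≤⟨ s≤s (injectiveOn⇒length≤ xs! inj′ into′) ⟩
    suc (length (ys₁ ++ ys₂)) ≡⟨ length-++-sucʳ ys₁ (f x) ys₂ ⟨
    length (ys₁ ++ f x ∷ ys₂) ∎
  where
  open ≤-Reasoning
  inj′ : ∀ {y z} → y ∈ₗ xs → z ∈ₗ xs → f y ≡ f z → y ≡ z
  inj′ y∈xs z∈xs = inj (there y∈xs) (there z∈xs)
  into′ : ∀ {y} → y ∈ₗ xs → f y ∈ₗ ys₁ ++ ys₂
  into′ {y} y∈xs with ∈-++⁻ ys₁ (into (there y∈xs))
  ... | inj₁ p            = ∈-++⁺ˡ p
  ... | inj₂ (here fy≡fx) =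
    contradiction (sym (inj (there y∈xs) (here refl) fy≡fx)) (All.lookup x∉xs y∈xs)
  ... | inj₂ (there p)    = ∈-++⁺ʳ ys₁ p

map⁺-injectiveOn : ∀ {A B : Set} {f : A → B} {xs : List A} →
                   (∀ {x y} → x ∈ₗ xs → y ∈ₗ xs → f x ≡ f y → x ≡ y) → Unique xs → Unique (map f xs)
map⁺-injectiveOn {xs = []}     _   []           = []
map⁺-injectiveOn {xs = x ∷ xs} inj (x∉xs ∷ xs!) =
  All.map⁺ (All.tabulate λ y∈xs fx≡fy → All.lookup x∉xs y∈xs (inj (here refl) (there y∈xs) fx≡fy))
  ∷ map⁺-injectiveOn (λ p q → inj (there p) (there q)) xs!

injective⇒≤ : ∀ {d m} (f : 𝔽₂^ d → 𝔽₂^ m) → Injective _≡_ _≡_ f → d ≤ m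
injective⇒≤ {d} {m} f f-inj = ≮⇒≥ λ m<d → <⇒≱ (^-monoʳ-< 2 (s≤s (s≤s z≤n)) m<d) 2^d≤2^m
  where
  2^d≤2^m : 2 ^ d ≤ 2 ^ m
  2^d≤2^m = subst₂ _≤_ (length-allVecs d) (length-allVecs m)
    (injectiveOn⇒length≤ (allVecs-unique d) (λ _ _ → f-inj) (λ _ → allVecs-complete _))

length-filter≡1 : ∀ {A : Set} {P : A → Set} (P? : Decidable P) {xs : List A} {a} →
                  Unique xs → a ∈ₗ xs → P a → (∀ {x} → P x → x ≡ a) → length (filter P? xs) ≡ 1
length-filter≡1 P? {xs} {a} xs! a∈xs Pa P⇒≡a = ≤-antisym
  (injectiveOn⇒length≤ {f = id} {ys = a ∷ []} (UP.filter⁺ P? xs!) (λ _ _ → id)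
                       (λ x∈ → here (P⇒≡a (proj₂ (∈-filter⁻ P? {xs = xs} x∈)))))
  (filter-some P? (lose a∈xs Pa))

length-filter-map : ∀ {A B : Set} {P : B → Set} (P? : Decidable P) (f : A → B) xs →
                    length (filter P? (map f xs)) ≡ length (filter (P? ∘ f) xs)
length-filter-map P? f []       = refl
length-filter-map P? f (x ∷ xs) with does (P? (f x))
... | true  = cong suc (length-filter-map P? f xs)
... | false = length-filter-map P? f xs

length-filter-allVecs : ∀ {m} {P : 𝔽₂^ (suc m) → Set} (P? : Decidable P) →
  length (filter P? (allVecs (suc m))) ≡
  length (filter (P? ∘ (false ∷_)) (allVecs m)) + length (filter (P? ∘ (true ∷_)) (allVecs m))
length-filter-allVecs {m} P? = begin
  length (filter P? (map (false ∷_) (allVecs m) ++ map (true ∷_) (allVecs m)))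
    ≡⟨ cong length (filter-++ P? (map (false ∷_) (allVecs m)) _) ⟩
  length (filter P? (map (false ∷_) (allVecs m)) ++ filter P? (map (true ∷_) (allVecs m)))
    ≡⟨ length-++ (filter P? (map (false ∷_) (allVecs m))) ⟩
  length (filter P? (map (false ∷_) (allVecs m))) + length (filter P? (map (true ∷_) (allVecs m)))
    ≡⟨ cong₂ _+_ (length-filter-map P? (false ∷_) (allVecs m))
                 (length-filter-map P? (true ∷_) (allVecs m)) ⟩
  length (filter (P? ∘ (false ∷_)) (allVecs m)) + length (filter (P? ∘ (true ∷_)) (allVecs m))
    ∎
  where open ≡-Reasoning

elements : ∀ {n} → 𝔽₂^ n → List (Fin n)
elements {n} p = filter (_∈? p) (allFin n)

elements-unique : ∀ {n} (p : 𝔽₂^ n) → Unique (elements p)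
elements-unique {n} p = UP.filter⁺ (_∈? p) (UP.allFin⁺ n)

∈-elements⁻ : ∀ {n} (p : 𝔽₂^ n) {i} → i ∈ₗ elements p → i ∈ᶜ p
∈-elements⁻ {n} p = proj₂ ∘ ∈-filter⁻ (_∈? p) {xs = allFin n}

length-elements : ∀ {n} (p : 𝔽₂^ n) → length (elements p) ≡ ∣ p ∣
length-elements []              = refl
length-elements {suc n} (s ∷ p) = begin
  length (filter (_∈? s ∷ p) (zero ∷ tabulate suc))
    ≡⟨ cong (length ∘ filter (_∈? s ∷ p) ∘ (zero ∷_)) (map-tabulate id suc) ⟨
  length (filter (_∈? s ∷ p) (zero ∷ map suc (allFin n)))
    ≡⟨ head+tail s ⟩
  ∣ s ∷ p ∣
    ∎
  where
  open ≡-Reasoning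
  tail : ∀ s → length (filter (_∈? s ∷ p) (map suc (allFin n))) ≡ ∣ p ∣
  tail s = begin
    length (filter (_∈? s ∷ p) (map suc (allFin n)))
      ≡⟨ length-filter-map (_∈? s ∷ p) suc (allFin n) ⟩
    length (filter ((_∈? s ∷ p) ∘ suc) (allFin n))
      ≡⟨ cong length (filter-≐ _ (_∈? p) (drop-there , Vec.there) (allFin n)) ⟩
    length (elements p)
      ≡⟨ length-elements p ⟩
    ∣ p ∣
      ∎
  head+tail : ∀ s → length (filter (_∈? s ∷ p) (zero ∷ map suc (allFin n))) ≡ ∣ s ∷ p ∣
  head+tail true  = cong suc (tail true)
  head+tail false = tail false

length-elements-∁ : ∀ {n} (p : 𝔽₂^ n) → length (elements (∁ p)) ≡ n ∸ ∣ p ∣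
length-elements-∁ p = trans (length-elements (∁ p)) (∣∁p∣≡n∸∣p∣ p)

C≤sucC : ∀ m k → m C k ≤ suc m C k
C≤sucC m zero    = ≤-refl
C≤sucC m (suc k) = ≤-trans (m≤n+m (m C suc k) (m C k)) (≤-reflexive (nCk+nC[k+1]≡[n+1]C[k+1] m k))

C-monoˡ-≤ : ∀ k {m n} → m ≤ n → m C k ≤ n C k
C-monoˡ-≤ k = go ∘ ≤⇒≤′
  where
  go : ∀ {m n} → m ≤′ n → m C k ≤ n C k
  go ≤′-refl        = ≤-refl
  go (≤′-step m≤′n) = ≤-trans (go m≤′n) (C≤sucC _ k)

weightAtMost : ∀ m → ℕ → List (𝔽₂^ m)
weightAtMost m w = filter (λ u → ∣ u ∣ ≤? w) (allVecs m)

length-weightAtMost : ∀ m w → length (weightAtMost m w) ≤ (m + w) C w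
length-weightAtMost zero    w       = ≤-reflexive (sym (nCn≡1 w))
length-weightAtMost (suc m) w       rewrite length-filter-allVecs {m} (λ u → ∣ u ∣ ≤? w) = go w
  where
  go : ∀ w → length (weightAtMost m w) + length (filter (λ u → suc ∣ u ∣ ≤? w) (allVecs m))
             ≤ (suc m + w) C w
  go zero    rewrite filter-none (λ u → suc ∣ u ∣ ≤? 0) (All.tabulate {xs = allVecs m} λ _ ()) =
    ≤-trans (≤-reflexive (+-identityʳ _)) (length-weightAtMost m zero)
  go (suc w)
    rewrite filter-≐ (λ u → suc ∣ u ∣ ≤? suc w) (λ u → ∣ u ∣ ≤? w) (s≤s⁻¹ , s≤s) (allVecs m) = begin
    length (weightAtMost m (suc w)) + length (weightAtMost m w)
      ≤⟨ +-mono-≤ (length-weightAtMost m (suc w)) (length-weightAtMost m w) ⟩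
    (m + suc w) C suc w + (m + w) C w
      ≤⟨ +-monoʳ-≤ ((m + suc w) C suc w) (C-monoˡ-≤ w (+-monoʳ-≤ m (n≤1+n w))) ⟩
    (m + suc w) C suc w + (m + suc w) C w
      ≡⟨ +-comm ((m + suc w) C suc w) _ ⟩
    (m + suc w) C w + (m + suc w) C suc w
      ≡⟨ nCk+nC[k+1]≡[n+1]C[k+1] (m + suc w) w ⟩
    suc (m + suc w) C suc w
      ∎
    where open ≤-Reasoning

restrict : ∀ {n} (p : 𝔽₂^ n) → 𝔽₂^ n → 𝔽₂^ ∣ p ∣
restrict []          []      = []
restrict (true  ∷ p) (a ∷ x) = a ∷ restrict p x
restrict (false ∷ p) (a ∷ x) = restrict p x

restrict-⊕ : ∀ {n} (p x y : 𝔽₂^ n) → restrict p (x ⊕ y) ≡ restrict p x ⊕ restrict p y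
restrict-⊕ []          []      []      = refl
restrict-⊕ (true  ∷ p) (a ∷ x) (b ∷ y) = cong ((a xor b) ∷_) (restrict-⊕ p x y)
restrict-⊕ (false ∷ p) (a ∷ x) (b ∷ y) = restrict-⊕ p x y

∣restrict∣≤ : ∀ {n} (p x : 𝔽₂^ n) → ∣ restrict p x ∣ ≤ ∣ x ∣
∣restrict∣≤ []          []          = z≤n
∣restrict∣≤ (true  ∷ p) (true  ∷ x) = s≤s (∣restrict∣≤ p x)
∣restrict∣≤ (true  ∷ p) (false ∷ x) = ∣restrict∣≤ p x
∣restrict∣≤ (false ∷ p) (true  ∷ x) = m≤n⇒m≤1+n (∣restrict∣≤ p x)
∣restrict∣≤ (false ∷ p) (false ∷ x) = ∣restrict∣≤ p x

restrict≡𝟎⇒⊆∁ : ∀ {n} (p x : 𝔽₂^ n) → restrict p x ≡ 𝟎 → x ⊆ᶜ ∁ p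
restrict≡𝟎⇒⊆∁ (true  ∷ p) (false ∷ x) eq (there i∈x) =
  there (restrict≡𝟎⇒⊆∁ p x (∷-injectiveʳ eq) i∈x)
restrict≡𝟎⇒⊆∁ (false ∷ p) (a     ∷ x) eq here        = here
restrict≡𝟎⇒⊆∁ (false ∷ p) (a     ∷ x) eq (there i∈x) = there (restrict≡𝟎⇒⊆∁ p x eq i∈x)

restrict-≡⇒⊕⊆∁ : ∀ {n} (p x y : 𝔽₂^ n) → restrict p x ≡ restrict p y → x ⊕ y ⊆ᶜ ∁ p
restrict-≡⇒⊕⊆∁ p x y eq = restrict≡𝟎⇒⊆∁ p (x ⊕ y) (begin
  restrict p (x ⊕ y)            ≡⟨ restrict-⊕ p x y ⟩
  restrict p x ⊕ restrict p y   ≡⟨ cong (_⊕ restrict p y) eq ⟩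
  restrict p y ⊕ restrict p y   ≡⟨ ⊕-self (restrict p y) ⟩
  𝟎                             ∎)
  where open ≡-Reasoning

-- Pivot sets

NoSupportIn : ∀ {n} → Subset n → 𝔽₂^ n → Set
NoSupportIn V R = ∀ y → y ∈ V → y ⊆ᶜ R → y ≡ 𝟎

-- Restriction to ∁ R is injective on V, so dim V ≤ n - ∣ R ∣.
∣∣≤codim : ∀ {n c} {V : Subset n} {R} → IsSubspace V → HasCodim V c → NoSupportIn V R → ∣ R ∣ ≤ c
∣∣≤codim {n} {c} {V} {R} V-sub (d , d+c≡n , bs , basis) free = ∸-cancelʳ-≤ (∣p∣≤n R) (begin
  n ∸ c     ≡⟨ cong (_∸ c) d+c≡n ⟨
  d + c ∸ c ≡⟨ m+n∸n≡m d c ⟩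
  d         ≤⟨ injective⇒≤ f f-injective ⟩
  ∣ ∁ R ∣   ≡⟨ ∣∁p∣≡n∸∣p∣ R ⟩
  n ∸ ∣ R ∣ ∎)
  where
  open ≤-Reasoning
  open IsBasis basis
  open IsSubspace V-sub
  f : 𝔽₂^ d → 𝔽₂^ ∣ ∁ R ∣
  f cs = restrict (∁ R) (lincomb bs cs)
  f-injective : Injective _≡_ _≡_ f
  f-injective {a} {b} fa≡fb = ⊕≡𝟎⇒≡ (independent (a ⊕ b)
    (trans (lincomb-⊕ bs a b) (free _ (add-mem _ _ (members a) (members b)) ⊕⊆R)))
    where
    ⊕⊆R : lincomb bs a ⊕ lincomb bs b ⊆ᶜ R
    ⊕⊆R = x∉∁p⇒x∈p ∘ x∈∁p⇒x∉p ∘ restrict-≡⇒⊕⊆∁ (∁ R) _ _ fa≡fb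

noSupportIn-𝟎 : ∀ {n} (V : Subset n) → NoSupportIn V 𝟎
noSupportIn-𝟎 V y _ y⊆𝟎 = Empty-unique λ (_ , i∈y) → ∉⊥ (y⊆𝟎 i∈y)

-- As x vanishes on R, ⟨ x , y ⟩ = yᵢ for y supported in R ∪ ⁅ i ⁆, so orthogonality forces yᵢ = 0.
noSupportIn-∪⁅⁆ : ∀ {n} {V : Subset n} {R x i} → NoSupportIn V R →
                  x ∈ (V ⊥) → x ⊆ᶜ ∁ R → i ∈ᶜ x → NoSupportIn V (R ∪ ⁅ i ⁆)
noSupportIn-∪⁅⁆ {V = V} {R} {x} {i} free x⊥V x⊆∁R i∈x y y∈V y⊆R∪i = free y y∈V y⊆R
  where
  x∩y⊆⁅i⁆ : x ∩ y ⊆ᶜ ⁅ i ⁆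
  x∩y⊆⁅i⁆ j∈x∩y with j∈x , j∈y ← x∈p∩q⁻ x y j∈x∩y | x∈p∪q⁻ R ⁅ i ⁆ (y⊆R∪i j∈y)
  ... | inj₁ j∈R    = contradiction j∈R (x∈∁p⇒x∉p (x⊆∁R j∈x))
  ... | inj₂ j∈⁅i⁆  = j∈⁅i⁆
  i∉y : i ∉ᶜ y
  i∉y i∈y = contradiction
    (trans (sym (⊥-orthogonal V x y x⊥V y∈V)) (parity-⊆⁅⁆ x∩y⊆⁅i⁆ (x∈p∩q⁺ (i∈x , i∈y)))) λ ()
  y⊆R : y ⊆ᶜ R
  y⊆R j∈y with x∈p∪q⁻ R ⁅ i ⁆ (y⊆R∪i j∈y)
  ... | inj₁ j∈R   = j∈R
  ... | inj₂ j∈⁅i⁆ = contradiction (subst (_∈ᶜ y) (x∈⁅y⁆⇒x≡y i j∈⁅i⁆) j∈y) i∉y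

PivotStep : ∀ {n} → Subset n → (𝔽₂^ n → Set) → Set → Set
PivotStep V P G = ∀ R → NoSupportIn V R → P R →
                  G ⊎ ∃[ i ] (i ∉ᶜ R × NoSupportIn V (R ∪ ⁅ i ⁆) × P (R ∪ ⁅ i ⁆))

growPivots : ∀ {n} {V : Subset n} (P : 𝔽₂^ n → Set) {G : Set} → PivotStep V P G → P 𝟎 → G
growPivots {V = V} P {G} step = go 𝟎 (⊃-wellFounded 𝟎) (noSupportIn-𝟎 V)
  where
  go : ∀ R → Acc _⊃_ R → NoSupportIn V R → P R → G
  go R (acc rec) free pR with step R free pR
  ... | inj₁ g                       = g
  ... | inj₂ (i , i∉R , free′ , pR′) = go (R ∪ ⁅ i ⁆) (rec (⊂∪⁅⁆ i∉R)) free′ pR′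

-- An information set of V ⊥

Determines : ∀ {n} → Subset n → 𝔽₂^ n → Set
Determines U Q = ∀ x → x ∈ U → x ⊆ᶜ ∁ Q → x ≡ 𝟎

informationSet : ∀ {n} (V : Subset n) → ∃[ Q ] (NoSupportIn V Q × Determines (V ⊥) Q)
informationSet V = growPivots (λ _ → ⊤) step tt
  where
  Witness : 𝔽₂^ _ → 𝔽₂^ _ → Set
  Witness R x = x ∈ (V ⊥) × Nonempty x × x ⊆ᶜ ∁ R

  step : PivotStep V (λ _ → ⊤) (∃[ Q ] (NoSupportIn V Q × Determines (V ⊥) Q))
  step R free _ with anyVec? {P = Witness R} (λ x → T? ((V ⊥) x) ×-dec nonempty? x ×-dec x ⊆? ∁ R)
  ... | no ∄x = inj₁ (R , free , λ x x⊥V x⊆∁R → Empty-unique λ x≠∅ → ∄x (x , x⊥V , x≠∅ , x⊆∁R))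
  ... | yes (x , x⊥V , (i , i∈x) , x⊆∁R) =
    inj₂ (i , x∈∁p⇒x∉p (x⊆∁R i∈x) , noSupportIn-∪⁅⁆ free x⊥V x⊆∁R i∈x , tt)

lowWeight : ∀ {n} → Subset n → ℕ → List (𝔽₂^ n)
lowWeight {n} U w = filter (λ x → T? (U x) ×-dec ∣ x ∣ ≤? w) (allVecs n)

module _ {n} (U : Subset n) (w : ℕ) where

  ∈-lowWeight⁻ : ∀ {x} → x ∈ₗ lowWeight U w → x ∈ U × ∣ x ∣ ≤ w
  ∈-lowWeight⁻ = proj₂ ∘ ∈-filter⁻ _ {xs = allVecs n}

  ∈-lowWeight⁺ : ∀ {x} → x ∈ U → ∣ x ∣ ≤ w → x ∈ₗ lowWeight U w
  ∈-lowWeight⁺ x∈U ∣x∣≤w = ∈-filter⁺ _ (allVecs-complete _) (x∈U , ∣x∣≤w)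

length-lowWeight : ∀ {n} {U : Subset n} {Q} → IsSubspace U → Determines U Q →
                   ∀ w → length (lowWeight U w) ≤ (∣ Q ∣ + w) C w
length-lowWeight {n} {U} {Q} U-sub Q-determines w = ≤-trans
  (injectiveOn⇒length≤ (UP.filter⁺ _ (allVecs-unique n)) restrict-injective into)
  (length-weightAtMost ∣ Q ∣ w)
  where
  open IsSubspace U-sub
  restrict-injective : ∀ {x y} → x ∈ₗ lowWeight U w → y ∈ₗ lowWeight U w →
                       restrict Q x ≡ restrict Q y → x ≡ y
  restrict-injective {x} {y} x∈ y∈ eq = ⊕≡𝟎⇒≡ (Q-determines (x ⊕ y)
    (add-mem x y (proj₁ (∈-lowWeight⁻ U w x∈)) (proj₁ (∈-lowWeight⁻ U w y∈)))
    (restrict-≡⇒⊕⊆∁ Q x y eq))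
  into : ∀ {x} → x ∈ₗ lowWeight U w → restrict Q x ∈ₗ weightAtMost ∣ Q ∣ w
  into {x} x∈ = ∈-filter⁺ _ (allVecs-complete _)
    (≤-trans (∣restrict∣≤ Q x) (proj₂ (∈-lowWeight⁻ U w x∈)))

length-lowWeight-⊥ : ∀ {n c} {V : Subset n} → IsSubspace V → HasCodim V c →
                     ∀ w → length (lowWeight (V ⊥) w) ≤ (c + w) C w
length-lowWeight-⊥ {V = V} V-sub V-codim w with Q , Q-free , Q-determines ← informationSet V =
  ≤-trans (length-lowWeight (⊥-isSubspace V) Q-determines w)
          (C-monoˡ-≤ w (+-monoˡ-≤ w (∣∣≤codim V-sub V-codim Q-free)))

-- Covering the supports of the low-weight vectors of V ⊥

Covers : ∀ {n} → Subset n → ℕ → 𝔽₂^ n → Set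
Covers U k K = ∀ v → v ∈ U → ∣ v ∣ ≤ k → v ⊆ᶜ K

-- The invariant of Gaussian elimination: K contains the supports of the vectors chosen so far,
-- R is their set of pivots, and every x ∈ U is reduced modulo their span to a vector vanishing
-- on R.
Reduces : ∀ {n} → Subset n → 𝔽₂^ n → 𝔽₂^ n → Set
Reduces U K R = ∀ x → x ∈ U → ∃[ y ] (y ∈ U × y ⊆ᶜ ∁ R × x ⊕ y ⊆ᶜ K)

reduces-𝟎 : ∀ {n} (U : Subset n) → Reduces U 𝟎 𝟎
reduces-𝟎 U x x∈U = x , x∈U , (λ _ → x∉p⇒x∈∁p ∉⊥) , ⊆-reflexive (⊕-self x)

reduces-∪⁅⁆ : ∀ {n} {U : Subset n} {K R y S i} → IsSubspace U → Reduces U K R →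
              y ∈ U → y ⊆ᶜ ∁ R → i ∈ᶜ y → y ⊆ᶜ S → K ⊆ᶜ S → Reduces U S (R ∪ ⁅ i ⁆)
reduces-∪⁅⁆ {y = y} {i = i} U-sub red y∈U y⊆∁R i∈y y⊆S K⊆S x x∈U
  with z , z∈U , z⊆∁R , x⊕z⊆K ← red x x∈U | i ∈? z
... | no  i∉z = z , z∈U , ⊆∁∪⁅⁆ z⊆∁R i∉z , K⊆S ∘ x⊕z⊆K
... | yes i∈z = z ⊕ y , add-mem z y z∈U y∈U , ⊆∁∪⁅⁆ (⊕-⊆ z⊆∁R y⊆∁R) (∉-⊕ z y i∈z i∈y) ,
                ⊕-⊆ (K⊆S ∘ x⊕z⊆K) y⊆S ∘ subst (_ ∈ᶜ_) (sym (⊕-assoc x z y))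
  where open IsSubspace U-sub

-- Each step adds to K a vector of weight ≤ k not yet covered, whose reduction supplies a new
-- pivot; as pivot sets have at most c elements, at most c vectors are added.
lowWeightCover : ∀ {n c} {V : Subset n} → IsSubspace V → HasCodim V c →
                 ∀ k → ∃[ K ] (∣ K ∣ ≤ c * k × Covers (V ⊥) k K)
lowWeightCover {n} {c} {V} V-sub V-codim k = growPivots Reduced step (𝟎 , reduces-𝟎 (V ⊥) , ∣𝟎∣≤)
  where
  Reduced : 𝔽₂^ n → Set
  Reduced R = ∃[ K ] (Reduces (V ⊥) K R × ∣ K ∣ ≤ ∣ R ∣ * k)

  ∣𝟎∣≤ : ∣ 𝟎 {n} ∣ ≤ ∣ 𝟎 {n} ∣ * k
  ∣𝟎∣≤ = subst (λ m → m ≤ m * k) (sym (∣⊥∣≡0 n)) z≤n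

  Escapes : 𝔽₂^ n → 𝔽₂^ n → Set
  Escapes K v = v ∈ (V ⊥) × ∣ v ∣ ≤ k × Nonempty (v ∩ ∁ K)

  step : PivotStep V Reduced (∃[ K ] (∣ K ∣ ≤ c * k × Covers (V ⊥) k K))
  step R free (K , red , ∣K∣≤)
    with anyVec? {P = Escapes K} (λ v → T? ((V ⊥) v) ×-dec ∣ v ∣ ≤? k ×-dec nonempty? (v ∩ ∁ K))
  ... | no ∄v = inj₁ (K , ≤-trans ∣K∣≤ (*-monoˡ-≤ k (∣∣≤codim V-sub V-codim free)) , covers)
    where
    covers : Covers (V ⊥) k K
    covers v v⊥V ∣v∣≤k {i} i∈v with i ∈? K
    ... | yes i∈K = i∈K
    ... | no  i∉K = contradiction (v , v⊥V , ∣v∣≤k , i , x∈p∩q⁺ (i∈v , x∉p⇒x∈∁p i∉K)) ∄v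
  ... | yes (v , v⊥V , ∣v∣≤k , i , i∈v∩∁K)
    with i∈v , i∈∁K ← x∈p∩q⁻ v (∁ K) i∈v∩∁K | y , y⊥V , y⊆∁R , v⊕y⊆K ← red v v⊥V
    = inj₂ (i , i∉R , noSupportIn-∪⁅⁆ free y⊥V y⊆∁R i∈y , v ∪ K ,
            reduces-∪⁅⁆ (⊥-isSubspace V) red y⊥V y⊆∁R i∈y y⊆v∪K (q⊆p∪q v K) , size)
    where
    i∈y : i ∈ᶜ y
    i∈y with i ∈? y
    ... | yes i∈y = i∈y
    ... | no  i∉y = contradiction (v⊕y⊆K (∈-⊕⁺ˡ v y i∈v i∉y)) (x∈∁p⇒x∉p i∈∁K)
    i∉R : i ∉ᶜ R
    i∉R = x∈∁p⇒x∉p (y⊆∁R i∈y)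
    y⊆v∪K : y ⊆ᶜ v ∪ K
    y⊆v∪K {j} j∈y with j ∈? v
    ... | yes j∈v = p⊆p∪q K j∈v
    ... | no  j∉v = q⊆p∪q v K (v⊕y⊆K (∈-⊕⁺ʳ v y j∉v j∈y))
    size : ∣ v ∪ K ∣ ≤ ∣ R ∪ ⁅ i ⁆ ∣ * k
    size = begin
      ∣ v ∪ K ∣          ≤⟨ ∣∪∣≤ v K ⟩
      ∣ v ∣ + ∣ K ∣      ≤⟨ +-mono-≤ ∣v∣≤k ∣K∣≤ ⟩
      suc ∣ R ∣ * k      ≤⟨ *-monoˡ-≤ k (p⊂q⇒∣p∣<∣q∣ (⊂∪⁅⁆ i∉R)) ⟩
      ∣ R ∪ ⁅ i ⁆ ∣ * k  ∎
      where open ≤-Reasoning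

-- Cosets of V ⊥

module _ {n} {U : Subset n} (U-sub : IsSubspace U) where

  open IsSubspace U-sub

  coset-sym : ∀ a b → (a ⊕ b) ∈ U → (b ⊕ a) ∈ U
  coset-sym a b = subst (_∈ U) (⊕-comm a b)

  coset-trans : ∀ a b c → (a ⊕ b) ∈ U → (b ⊕ c) ∈ U → (a ⊕ c) ∈ U
  coset-trans a b c a⊕b∈U b⊕c∈U = subst (_∈ U) (⊕-telescope a b c) (add-mem _ _ a⊕b∈U b⊕c∈U)

representative : ∀ {n} {W U : Subset n} → DirectSumWhole W U → ∀ x → ∃[ w ] (w ∈ W × (w ⊕ x) ∈ U)
representative {U = U} (_ , decompose) x with w , u , w∈W , u∈U , x≡w⊕u ← decompose x =
  w , w∈W , subst (_∈ U) (sym w⊕x≡u) u∈U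
  where
  w⊕x≡u : w ⊕ x ≡ u
  w⊕x≡u = begin
    w ⊕ x       ≡⟨ cong (w ⊕_) x≡w⊕u ⟩
    w ⊕ (w ⊕ u) ≡⟨ ⊕-assoc w w u ⟨
    (w ⊕ w) ⊕ u ≡⟨ cong (_⊕ u) (⊕-self w) ⟩
    𝟎 ⊕ u       ≡⟨ ⊕-identityˡ u ⟩
    u           ∎
    where open ≡-Reasoning

module _ {n} (U : Subset n) (γ : 𝔽₂^ n) (t : ℕ) where

  inCoset⁻ : ∀ u → T (U (u ⊕ γ) ∧ (weight u ≡ᵇ t)) → (u ⊕ γ) ∈ U × ∣ u ∣ ≡ t
  inCoset⁻ u = Product.map₂ (trans (sym (weight≡∣∣ u)) ∘ ≡ᵇ⇒≡ _ t) ∘ Equivalence.to T-∧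

  inCoset⁺ : ∀ u → (u ⊕ γ) ∈ U → ∣ u ∣ ≡ t → T (U (u ⊕ γ) ∧ (weight u ≡ᵇ t))
  inCoset⁺ u u⊕γ∈U ∣u∣≡t = Equivalence.from T-∧ (u⊕γ∈U , ≡⇒≡ᵇ _ t (trans (weight≡∣∣ u) ∣u∣≡t))

cosetWeightCount-cong : ∀ {n} {U : Subset n} {γ δ} → IsSubspace U → (γ ⊕ δ) ∈ U →
                        ∀ t → cosetWeightCount γ U t ≡ cosetWeightCount δ U t
cosetWeightCount-cong {n} {U} {γ} {δ} U-sub γ⊕δ∈U t =
  cong length (filter-≐ (inCoset? γ) (inCoset? δ)
                        (move γ⊕δ∈U , move (coset-sym U-sub γ δ γ⊕δ∈U)) (allVecs n))
  where
  inCoset? : ∀ γ (u : 𝔽₂^ n) → Dec (T (U (u ⊕ γ) ∧ (weight u ≡ᵇ t)))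
  inCoset? γ u = T? (U (u ⊕ γ) ∧ (weight u ≡ᵇ t))
  move : ∀ {a b} → (a ⊕ b) ∈ U →
         ∀ {u} → T (U (u ⊕ a) ∧ (weight u ≡ᵇ t)) → T (U (u ⊕ b) ∧ (weight u ≡ᵇ t))
  move {a} {b} a⊕b∈U {u} h with u⊕a∈U , ∣u∣≡t ← inCoset⁻ U a t u h =
    inCoset⁺ U b t u (coset-trans U-sub u a b u⊕a∈U a⊕b∈U) ∣u∣≡t

module IsolatedCoordinate {n} {U : Subset n} (U-sub : IsSubspace U)
                          {ℓ K} (K-covers : Covers U (ℓ + 1) K) {i} (i∉K : i ∉ᶜ K) where

  open IsSubspace U-sub

  ∈-of-coset : ∀ {u} → (u ⊕ ⁅ i ⁆) ∈ U → ∣ u ∣ ≤ ℓ → i ∈ᶜ u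
  ∈-of-coset {u} u⊕⁅i⁆∈U ∣u∣≤ℓ with i ∈? u
  ... | yes i∈u = i∈u
  ... | no  i∉u = contradiction (K-covers _ u⊕⁅i⁆∈U ∣u⊕⁅i⁆∣≤ (∈-⊕⁺ʳ u ⁅ i ⁆ i∉u (x∈⁅x⁆ i))) i∉K
    where
    ∣u⊕⁅i⁆∣≤ : ∣ u ⊕ ⁅ i ⁆ ∣ ≤ ℓ + 1
    ∣u⊕⁅i⁆∣≤ = ≤-trans (∣⊕∣≤ u ⁅ i ⁆) (+-mono-≤ ∣u∣≤ℓ (≤-reflexive (∣⁅x⁆∣≡1 i)))

  suc∣⊕⁅⁆∣ : ∀ {u} → (u ⊕ ⁅ i ⁆) ∈ U → ∣ u ∣ ≤ ℓ → suc ∣ u ⊕ ⁅ i ⁆ ∣ ≡ ∣ u ∣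
  suc∣⊕⁅⁆∣ {u} u⊕⁅i⁆∈U ∣u∣≤ℓ = ∣⊕⁅⁆∣ u (∈-of-coset u⊕⁅i⁆∈U ∣u∣≤ℓ)

  module _ (γ : 𝔽₂^ n) (γ⊕⁅i⁆∈U : (γ ⊕ ⁅ i ⁆) ∈ U) where

    coset-⁅⁆-unique : 1 ≤ ℓ → ∀ {j} → (γ ⊕ ⁅ j ⁆) ∈ U → i ≡ j
    coset-⁅⁆-unique 1≤ℓ {j} γ⊕⁅j⁆∈U = x∈⁅y⁆⇒x≡y j (∈-of-coset ⁅j⁆⊕⁅i⁆∈U ∣⁅j⁆∣≤ℓ)
      where
      ⁅j⁆⊕⁅i⁆∈U = coset-trans U-sub ⁅ j ⁆ γ ⁅ i ⁆ (coset-sym U-sub γ ⁅ j ⁆ γ⊕⁅j⁆∈U) γ⊕⁅i⁆∈U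
      ∣⁅j⁆∣≤ℓ = subst (_≤ ℓ) (sym (∣⁅x⁆∣≡1 j)) 1≤ℓ

    cosetWeightCount≡1 : 1 ≤ ℓ → cosetWeightCount γ U 1 ≡ 1
    cosetWeightCount≡1 1≤ℓ = trans (cosetWeightCount-cong U-sub γ⊕⁅i⁆∈U 1)
      (length-filter≡1 _ (allVecs-unique n) (allVecs-complete ⁅ i ⁆) ⁅i⁆∈ unique)
      where
      ⁅i⁆∈ : T (U (⁅ i ⁆ ⊕ ⁅ i ⁆) ∧ (weight ⁅ i ⁆ ≡ᵇ 1))
      ⁅i⁆∈ = inCoset⁺ U ⁅ i ⁆ 1 ⁅ i ⁆ (subst (_∈ U) (sym (⊕-self ⁅ i ⁆)) zero-mem) (∣⁅x⁆∣≡1 i)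
      unique : ∀ {u} → T (U (u ⊕ ⁅ i ⁆) ∧ (weight u ≡ᵇ 1)) → u ≡ ⁅ i ⁆
      unique {u} h with u⊕⁅i⁆∈U , ∣u∣≡1 ← inCoset⁻ U ⁅ i ⁆ 1 u h =
        ⊕≡𝟎⇒≡ (∣∣≡0⇒≡𝟎 _ (suc-injective (trans (suc∣⊕⁅⁆∣ u⊕⁅i⁆∈U ∣u∣≤ℓ) ∣u∣≡1)))
        where
        ∣u∣≤ℓ : ∣ u ∣ ≤ ℓ
        ∣u∣≤ℓ = subst (_≤ ℓ) (sym ∣u∣≡1) 1≤ℓ

    cosetWeightCount≤ : ∀ {t} → t ≤ ℓ → cosetWeightCount γ U t ≤ length (lowWeight U (t ∸ 1))
    cosetWeightCount≤ {t} t≤ℓ = begin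
      cosetWeightCount γ U t
        ≡⟨ cosetWeightCount-cong U-sub γ⊕⁅i⁆∈U t ⟩
      cosetWeightCount ⁅ i ⁆ U t
        ≤⟨ injectiveOn⇒length≤ (UP.filter⁺ _ (allVecs-unique n)) (λ _ _ → ⊕-cancelʳ-≡) into ⟩
      length (lowWeight U (t ∸ 1))
        ∎
      where
      open ≤-Reasoning
      into : ∀ {u} → u ∈ₗ filterᵇ (λ u → U (u ⊕ ⁅ i ⁆) ∧ (weight u ≡ᵇ t)) (allVecs n) →
             (u ⊕ ⁅ i ⁆) ∈ₗ lowWeight U (t ∸ 1)
      into {u} u∈
        with u⊕⁅i⁆∈U , ∣u∣≡t ← inCoset⁻ U ⁅ i ⁆ t u (proj₂ (∈-filter⁻ _ {xs = allVecs n} u∈)) =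
        ∈-lowWeight⁺ U (t ∸ 1) u⊕⁅i⁆∈U
          (≤-reflexive (cong (_∸ 1) (trans (suc∣⊕⁅⁆∣ u⊕⁅i⁆∈U ∣u∣≤ℓ) ∣u∣≡t)))
        where
        ∣u∣≤ℓ : ∣ u ∣ ≤ ℓ
        ∣u∣≤ℓ = subst (_≤ ℓ) (sym ∣u∣≡t) t≤ℓ

m≤n+1⇒n+[m∸1]≤2n+1 : ∀ {m n} → m ≤ n + 1 → n + (m ∸ 1) ≤ 2 * n + 1
m≤n+1⇒n+[m∸1]≤2n+1 {m} {n} m≤n+1 = begin
  n + (m ∸ 1) ≤⟨ +-monoʳ-≤ n (≤-trans (m∸n≤m m 1) m≤n+1) ⟩
  n + (n + 1) ≡⟨ +-assoc n n 1 ⟨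
  n + n + 1   ≡⟨ cong (λ k → n + k + 1) (+-identityʳ n) ⟨
  2 * n + 1   ∎
  where open ≤-Reasoning

lemma4p14 : (n c : ℕ) (V W : Subset n) →
    IsSubspace V → HasCodim V c →
    IsSubspace W → DirectSumWhole W (V ⊥) →
    (ℓ : ℕ) → 1 ≤ ℓ → ℓ ≤ c + 1 →
    ∃[ S ] (Unique S × All (λ γ → γ ∈ W) S × length S ≥ n ∸ c * (ℓ + 1) ×
      All (λ γ → cosetWeightCount γ (V ⊥) 1 ≡ 1 ×
                 ((t : ℕ) → 1 ≤ t → t ≤ ℓ →
                   cosetWeightCount γ (V ⊥) t ≤ 2 * (((2 * c + 1) C (t ∸ 1))))) S)
lemma4p14 n c V W V-sub V-codim _ W⊕V⊥ ℓ 1≤ℓ ℓ≤c+1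
  with K , ∣K∣≤ , K-covers ← lowWeightCover V-sub V-codim (ℓ + 1) =
  map π I , map⁺-injectiveOn π-injective (elements-unique (∁ K)) ,
  All.map⁺ (All.tabulate λ {i} _ → proj₁ (proj₂ (representative W⊕V⊥ ⁅ i ⁆))) ,
  ≤-trans (∸-monoʳ-≤ n ∣K∣≤) (≤-reflexive (sym (trans (length-map π I) (length-elements-∁ K)))) ,
  All.map⁺ (All.tabulate λ i∈I → weight-1 i∈I , weight-t i∈I)
  where
  open module Isolated {i} = IsolatedCoordinate (⊥-isSubspace V) K-covers {i}
  I : List (Fin n)
  I = elements (∁ K)
  ∉K : ∀ {i} → i ∈ₗ I → i ∉ᶜ K
  ∉K = x∈∁p⇒x∉p ∘ ∈-elements⁻ (∁ K)
  π : Fin n → 𝔽₂^ n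
  π i = proj₁ (representative W⊕V⊥ ⁅ i ⁆)
  π⊕⁅⁆∈U : ∀ i → (π i ⊕ ⁅ i ⁆) ∈ (V ⊥)
  π⊕⁅⁆∈U i = proj₂ (proj₂ (representative W⊕V⊥ ⁅ i ⁆))
  π-injective : ∀ {i j} → i ∈ₗ I → j ∈ₗ I → π i ≡ π j → i ≡ j
  π-injective {i} {j} i∈I _ πi≡πj = coset-⁅⁆-unique (∉K i∈I) (π i) (π⊕⁅⁆∈U i) 1≤ℓ
    (subst (λ γ → (γ ⊕ ⁅ j ⁆) ∈ (V ⊥)) (sym πi≡πj) (π⊕⁅⁆∈U j))
  weight-1 : ∀ {i} → i ∈ₗ I → cosetWeightCount (π i) (V ⊥) 1 ≡ 1
  weight-1 {i} i∈I = cosetWeightCount≡1 (∉K i∈I) (π i) (π⊕⁅⁆∈U i) 1≤ℓ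
  -- The bound holds for t = 0 as well.
  weight-t : ∀ {i} → i ∈ₗ I → ∀ t → 1 ≤ t → t ≤ ℓ →
             cosetWeightCount (π i) (V ⊥) t ≤ 2 * ((2 * c + 1) C (t ∸ 1))
  weight-t {i} i∈I t _ t≤ℓ = begin
    cosetWeightCount (π i) (V ⊥) t   ≤⟨ cosetWeightCount≤ (∉K i∈I) (π i) (π⊕⁅⁆∈U i) t≤ℓ ⟩
    length (lowWeight (V ⊥) (t ∸ 1)) ≤⟨ length-lowWeight-⊥ V-sub V-codim (t ∸ 1) ⟩
    (c + (t ∸ 1)) C (t ∸ 1)          ≤⟨ C-monoˡ-≤ (t ∸ 1) (m≤n+1⇒n+[m∸1]≤2n+1 (≤-trans t≤ℓ ℓ≤c+1)) ⟩
    (2 * c + 1) C (t ∸ 1)            ≤⟨ m≤m+n _ _ ⟩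
    2 * ((2 * c + 1) C (t ∸ 1))      ∎
    where open ≤-Reasoning
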